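{- For deterministic algorithms, each of the following problems cannot be solved in time less than $\Omega(|G|)$: (1) given two finite Abelian groups $G$ and $H$, decide whether $G$ is isomorphic to $H$; (2) given a finite Abelian group $G$, find a basis for $G$; (3) given a finite Abelian group $G$ with $n=|G|$, find generators for $G$ together with defining relations, where the size of this presentation (number of generators and relations) is at most $n^{o(1)}$.
   Context: The algorithm accesses the group only through its elements and its Cayley table (product of any two elements), each access costing unit time. A basis of a finite Abelian group $G$ is a tuple $a_1,\dots,a_t\in G$ of elements of order at least $2$ such that $G=\langle a_1\rangle\times\cdots\times\langle a_t\rangle$ (internal direct product). -}

module Defs where

open import Data.Nat using (ℕ; zero; suc; _+_; _*_; _^_; _≤_)
open import Data.Integer as ℤ using (ℤ; +_; -[1+_])
open import Data.Fin using (Fin)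
open import Data.Bool using (Bool; true; false)
open import Data.List using (List; []; _∷_; length; foldr)
open import Data.List.Relation.Unary.All using (All)
open import Data.List.Relation.Binary.Pointwise using (Pointwise)
open import Data.Vec as Vec using (Vec; []; _∷_; fromList; zipWith; replicate)
open import Data.Product using (Σ; ∃; ∃-syntax; _×_; _,_)
open import Relation.Binary.PropositionalEquality using (_≡_; _≢_)
open import Relation.Nullary using (¬_)
open import Function using (_⇔_)
open import Function.Definitions using (Bijective)
open import Algebra.Structures using (IsAbelianGroup)

-- Input model: a finite Abelian group of order n whose elements are the
-- labels Fin n, given by its Cayley table _∙_.  The identity and inverse
-- are part of the mathematical structure, but an algorithm only sees the
-- table through queries (see Tree below).

record AbGroupOn (n : ℕ) : Set where
  field
    _∙_        : Fin n → Fin n → Fin n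
    ε          : Fin n
    _⁻¹        : Fin n → Fin n
    isAbGroup  : IsAbelianGroup _≡_ _∙_ ε _⁻¹

module _ {n : ℕ} (G : AbGroupOn n) where
  open AbGroupOn G

  pow : Fin n → ℕ → Fin n
  pow a zero    = ε
  pow a (suc k) = a ∙ pow a k

  zpow : Fin n → ℤ → Fin n
  zpow a (+ k)      = pow a k
  zpow a -[1+ k ]   = (pow a (suc k)) ⁻¹

  prod : List (Fin n) → Fin n
  prod = foldr _∙_ ε

  -- x ∈ ⟨ a ⟩  (cyclic subgroup generated by a; G finite, so ℕ-powers suffice)
  InCyclic : Fin n → Fin n → Set
  InCyclic x a = ∃[ k ] x ≡ pow a k

  OrderAtLeast2 : Fin n → Set
  OrderAtLeast2 a = pow a 1 ≢ ε

  IsInternalDirectProduct : List (Fin n) → Set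
  IsInternalDirectProduct as =
    (g : Fin n) → Σ (List (Fin n)) λ xs →
      (Pointwise InCyclic xs as × prod xs ≡ g) ×
      ((ys : List (Fin n)) → Pointwise InCyclic ys as → prod ys ≡ g → ys ≡ xs)

  IsBasis : List (Fin n) → Set
  IsBasis as = All OrderAtLeast2 as × IsInternalDirectProduct as

  -- Abelian-group presentations: k generators, relations are integer vectors
  -- r ∈ ℤᵏ (standing for Σ rᵢ gᵢ = 0, i.e. ∏ gᵢ^{rᵢ} = ε).
  evalWord : ∀ {k} → Vec (Fin n) k → Vec ℤ k → Fin n
  evalWord []       []       = ε
  evalWord (g ∷ gs) (z ∷ zs) = zpow g z ∙ evalWord gs zs

  Presentation : Set
  Presentation = Σ (List (Fin n)) λ gs → List (Vec ℤ (length gs))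

  presSize : Presentation → ℕ
  presSize (gs , rs) = length gs + length rs

linComb : ∀ {k} → List (Vec ℤ k) → List ℤ → Vec ℤ k
linComb {k} (r ∷ rs) (c ∷ cs) = zipWith ℤ._+_ (Vec.map (c ℤ.*_) r) (linComb rs cs)
linComb {k} _        _        = replicate k (+ 0)

InSpan : ∀ {k} → List (Vec ℤ k) → Vec ℤ k → Set
InSpan rs v = ∃[ cs ] (length cs ≡ length rs × v ≡ linComb rs cs)

module _ {n : ℕ} (G : AbGroupOn n) where
  open AbGroupOn G

  Presents : Presentation G → Set
  Presents (gs , rs) =
    ((g : Fin n) → ∃[ v ] evalWord G (fromList gs) v ≡ g) ×
    All (λ r → evalWord G (fromList gs) r ≡ ε) rs ×
    ((v : Vec ℤ (length gs)) → evalWord G (fromList gs) v ≡ ε → InSpan rs v)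

Isomorphic : ∀ {n} → AbGroupOn n → AbGroupOn n → Set
Isomorphic {n} G H =
  Σ (Fin n → Fin n) λ f → Bijective _≡_ _≡_ f ×
    (∀ a b → f (AbGroupOn._∙_ G a b) ≡ AbGroupOn._∙_ H (f a) (f b))

-- Deterministic algorithms in the Cayley-table model: adaptive query trees.
-- Each query (a question q : Q) is answered by the oracle (A) at unit cost;
-- the time of an algorithm is at least the number of queries it makes.

data Tree (Q A O : Set) : Set where
  leaf : O → Tree Q A O
  ask  : Q → (A → Tree Q A O) → Tree Q A O

run : ∀ {Q A O} → Tree Q A O → (Q → A) → O
run (leaf o)  orc = o
run (ask q k) orc = run (k (orc q)) orc

cost : ∀ {Q A O} → Tree Q A O → (Q → A) → ℕ
cost (leaf o)  orc = 0
cost (ask q k) orc = suc (cost (k (orc q)) orc)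

table : ∀ {n} → AbGroupOn n → Fin n × Fin n → Fin n
table G (a , b) = AbGroupOn._∙_ G a b

table₂ : ∀ {n} → AbGroupOn n → AbGroupOn n → Bool × Fin n × Fin n → Fin n
table₂ G H (true  , a , b) = AbGroupOn._∙_ G a b
table₂ G H (false , a , b) = AbGroupOn._∙_ H a b

-- s(n) = n^{o(1)}:  for every k ≥ 1, eventually s(n) ≤ n^{1/k}, i.e. s(n)^k ≤ n.
SubPolynomial : (ℕ → ℕ) → Set
SubPolynomial s = (k : ℕ) → ∃[ N ] ((n : ℕ) → N ≤ n → s n ^ suc k ≤ n)

DecidesIso : ∀ {n} → Tree (Bool × Fin n × Fin n) (Fin n) Bool → Set
DecidesIso {n} T = (G H : AbGroupOn n) → (run T (table₂ G H) ≡ true ⇔ Isomorphic G H)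

FindsBasis : ∀ {n} → Tree (Fin n × Fin n) (Fin n) (List (Fin n)) → Set
FindsBasis {n} T = (G : AbGroupOn n) → IsBasis G (run T (table G))

-- the output type for problem (3) does not depend on G (only on n)
PresOut : ℕ → Set
PresOut n = Σ (List (Fin n)) λ gs → List (Vec ℤ (length gs))

FindsPresentation : ∀ {n} → (ℕ → ℕ) → Tree (Fin n × Fin n) (Fin n) (PresOut n) → Set
FindsPresentation {n} s T = (G : AbGroupOn n) →
  Presents G (run T (table G)) × presSize G (run T (table G)) ≤ s n

{-# OPTIONS --safe #-}
module Submission where

open import Defs
open import Data.Nat using (ℕ; _*_; _≤_)
open import Data.Fin using (Fin)
open import Data.Bool using (Bool)
open import Data.List using (List)
open import Data.Product using (Σ; ∃; ∃-syntax; _×_; _,_)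

open import Algebra.Bundles using (AbelianGroup)
open import Algebra.Consequences.Propositional using (comm∧idˡ⇒id; comm∧invˡ⇒inv)
open import Algebra.Core using (Op₁; Op₂)
open import Algebra.Morphism.Definitions using (Homomorphic₂)
import Algebra.Properties.AbelianGroup as AbelianGroupProperties
open import Algebra.Structures using (IsAbelianGroup)
open import Data.Bool.Base using (true; false)
open import Data.Empty using (⊥-elim)
open import Data.Fin.Base using (toℕ; fromℕ<; remQuot; combine)
open import Data.Fin.Permutation as Perm using (Permutation′; _⟨$⟩ʳ_; _⟨$⟩ˡ_)
import Data.Fin.Permutation.Components as PC
open import Data.Fin.Properties using (_≟_; toℕ-fromℕ<; toℕ-injective; toℕ<n; *↔×; remQuot-combine; combine-remQuot; pigeonhole; ¬∀⟶∃¬; <⇒≢)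
open import Data.Integer.Base using (+_; -[1+_])
import Data.List.Base as List
open import Data.List.Base using ([]; _∷_; _++_; length)
open import Data.List.Membership.Propositional using (_∈_; _∉_)
open import Data.List.Membership.Propositional.Properties using (∈-map⁻; ∈-map⁺)
open import Data.List.Properties using (∷-injectiveˡ; ++-cancelˡ; length-map; map-∘)
open import Data.List.Relation.Binary.Pointwise as Pointwise using (Pointwise; []; _∷_)
open import Data.List.Relation.Binary.Subset.Propositional using (_⊆_)
open import Data.List.Relation.Unary.All as All using (All; []; _∷_)
import Data.List.Relation.Unary.All.Properties as All
open import Data.List.Relation.Unary.Any as Any using (here; there)
open import Data.List.Relation.Unary.Any.Properties using (lookup-index)
open import Data.List.Relation.Unary.First as First using (first)
open import Data.List.Relation.Unary.First.Properties using (toView)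
open import Data.Nat.Base using (zero; suc; _+_; _∸_; _^_; _<_; z≤n; s≤s; NonZero; >-nonZero⁻¹)
open import Data.Nat.Divisibility using (_∣_; ∣-refl; ∣-trans; m∣m*n; n∣m⇒m%n≡0; ∣1⇒≡1; ∣m+n∣m⇒∣n)
open import Data.Nat.DivMod using (_%_; _mod_; %-distribˡ-+; m%n%n≡m%n; m<n⇒m%n≡m; n%n≡0; m%n<n; m%n*o≡m*o%[n*o]; %-congʳ)
import Data.Nat.Properties as ℕ
open import Data.Product using (Σ-syntax; proj₁; proj₂; uncurry; map₂)
open import Data.Sum using (_⊎_; inj₁; inj₂)
open import Data.Vec.Base using (fromList; []; _∷_)
open import Function.Base using (_∘_)
open import Function.Bundles using (_↔_; Inverse; Bijection; Injection; Equivalence)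
open import Function.Properties.Inverse using (Inverse⇒Bijection; Inverse⇒Injection)
open import Level using (0ℓ)
open import Relation.Binary.Definitions using (DecidableEquality)
open import Relation.Binary.PropositionalEquality
open import Relation.Nullary using (¬_; yes; no; contradiction)
open import Relation.Nullary.Decidable using (dec-true; dec-false; toSum)

-- An adversary answers every Cayley-table query as if the input were the subgroup H = ℤ/M,
-- M = n/2: the labels seen so far are matched injectively with elements of H, and the
-- product of two labels is the label of the product of their elements (fresh labels and
-- elements are chosen when needed).  After K = n/8 queries at most 3K labels are matched,
-- and every such matching is realised by a relabelling of ℤ/n and of ℤ/2 × ℤ/M, in both of
-- which H is the subgroup of index two.  A faster algorithm therefore sees the same answers
-- on inputs on which its output has to differ:
-- (1) ℤ/n and ℤ/2 × ℤ/M are not isomorphic, since only the latter has exponent M;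
-- (2) if at most one output label is unmatched, it can be matched into H as well, and a list
--     inside a proper subgroup is no basis; if two labels u, v are unmatched, sending v to 1
--     and u to 3 = 1³ puts u into ⟨v⟩;
-- (3) a presentation with at most n^{o(1)} ≤ K generators can be matched into H.

-- Abelian groups on labels

module _ {C : Set} {_·_ : Op₂ C} {e : C} {inv : Op₁ C} where
  open import Algebra.Definitions {A = C} _≡_

  isAbelianGroupˡ : Associative _·_ → LeftIdentity e _·_ → LeftInverse e inv _·_ →
                    Commutative _·_ → IsAbelianGroup _≡_ _·_ e inv
  isAbelianGroupˡ assoc idˡ invˡ comm = record
    { isGroup = record
      { isMonoid = record
        { isSemigroup = record
          { isMagma = record { isEquivalence = isEquivalence ; ∙-cong = cong₂ _·_ }
          ; assoc = assoc }
        ; identity = comm∧idˡ⇒id comm idˡ }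
      ; inverse = comm∧invˡ⇒inv comm invˡ
      ; ⁻¹-cong = cong inv }
    ; comm = comm }

module Transport {n : ℕ} {C : Set} {_·_ : Op₂ C} {e : C} {inv : Op₁ C}
                 (isAbGroup : IsAbelianGroup _≡_ _·_ e inv) (β : Fin n ↔ C) where
  open Inverse β using (to; from; strictlyInverseˡ; strictlyInverseʳ)
  open IsAbelianGroup isAbGroup using (assoc; identityˡ; inverseˡ; comm)

  transport : AbGroupOn n
  transport = record
    { _∙_ = λ a b → from (to a · to b)
    ; ε = from e
    ; _⁻¹ = λ a → from (inv (to a))
    ; isAbGroup = isAbelianGroupˡ
        (λ a b c → cong from (begin
          to (from (to a · to b)) · to c ≡⟨ cong (_· to c) (strictlyInverseˡ _) ⟩
          (to a · to b) · to c           ≡⟨ assoc _ _ _ ⟩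
          to a · (to b · to c)           ≡⟨ cong (to a ·_) (strictlyInverseˡ _) ⟨
          to a · to (from (to b · to c)) ∎))
        (λ a → trans (cong (λ x → from (x · to a)) (strictlyInverseˡ e))
                     (trans (cong from (identityˡ _)) (strictlyInverseʳ a)))
        (λ a → cong from (trans (cong (_· to a) (strictlyInverseˡ _)) (inverseˡ _)))
        (λ a b → cong from (comm _ _))
    }
    where open ≡-Reasoning

  open AbGroupOn transport using (_∙_)

  to-∙ : ∀ a b → to (a ∙ b) ≡ to a · to b
  to-∙ a b = strictlyInverseˡ _

  from-∙ : ∀ x y → from (x · y) ≡ from x ∙ from y
  from-∙ x y = cong from (sym (cong₂ _·_ (strictlyInverseˡ x) (strictlyInverseˡ y)))

module Modular (N : ℕ) .{{_ : NonZero N}} where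
  infixl 6 _+ₘ_

  _+ₘ_ : Op₂ (Fin N)
  a +ₘ b = (toℕ a + toℕ b) mod N

  0ₘ : Fin N
  0ₘ = 0 mod N

  -ₘ_ : Op₁ (Fin N)
  -ₘ a = (N ∸ toℕ a) mod N

  toℕ-mod : ∀ m → toℕ (m mod N) ≡ m % N
  toℕ-mod m = toℕ-fromℕ< (m%n<n m N)

  toℕ-0ₘ : toℕ 0ₘ ≡ 0
  toℕ-0ₘ = trans (toℕ-mod 0) (m<n⇒m%n≡m (>-nonZero⁻¹ N))

  [m%N+k]%N≡[m+k]%N : ∀ m k → (m % N + k) % N ≡ (m + k) % N
  [m%N+k]%N≡[m+k]%N m k = begin
    (m % N + k) % N         ≡⟨ %-distribˡ-+ (m % N) k N ⟩
    (m % N % N + k % N) % N ≡⟨ cong (λ x → (x + k % N) % N) (m%n%n≡m%n m N) ⟩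
    (m % N + k % N) % N     ≡⟨ %-distribˡ-+ m k N ⟨
    (m + k) % N             ∎
    where open ≡-Reasoning

  [m+k%N]%N≡[m+k]%N : ∀ m k → (m + k % N) % N ≡ (m + k) % N
  [m+k%N]%N≡[m+k]%N m k = begin
    (m + k % N) % N ≡⟨ cong (_% N) (ℕ.+-comm m (k % N)) ⟩
    (k % N + m) % N ≡⟨ [m%N+k]%N≡[m+k]%N k m ⟩
    (k + m) % N     ≡⟨ cong (_% N) (ℕ.+-comm k m) ⟩
    (m + k) % N     ∎
    where open ≡-Reasoning

  +ₘ-assoc : ∀ a b c → (a +ₘ b) +ₘ c ≡ a +ₘ (b +ₘ c)
  +ₘ-assoc a b c = toℕ-injective (begin
    toℕ ((a +ₘ b) +ₘ c)                     ≡⟨ toℕ-mod _ ⟩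
    (toℕ (a +ₘ b) + toℕ c) % N              ≡⟨ cong (λ x → (x + toℕ c) % N) (toℕ-mod _) ⟩
    ((toℕ a + toℕ b) % N + toℕ c) % N       ≡⟨ [m%N+k]%N≡[m+k]%N _ _ ⟩
    (toℕ a + toℕ b + toℕ c) % N             ≡⟨ cong (_% N) (ℕ.+-assoc (toℕ a) _ _) ⟩
    (toℕ a + (toℕ b + toℕ c)) % N           ≡⟨ [m+k%N]%N≡[m+k]%N _ _ ⟨
    (toℕ a + (toℕ b + toℕ c) % N) % N       ≡⟨ cong (λ x → (toℕ a + x) % N) (toℕ-mod _) ⟨
    (toℕ a + toℕ (b +ₘ c)) % N              ≡⟨ toℕ-mod _ ⟨
    toℕ (a +ₘ (b +ₘ c))                     ∎)
    where open ≡-Reasoning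

  +ₘ-identityˡ : ∀ a → 0ₘ +ₘ a ≡ a
  +ₘ-identityˡ a = toℕ-injective (begin
    toℕ (0ₘ +ₘ a)           ≡⟨ toℕ-mod _ ⟩
    (toℕ 0ₘ + toℕ a) % N    ≡⟨ cong (λ x → (x + toℕ a) % N) toℕ-0ₘ ⟩
    toℕ a % N               ≡⟨ m<n⇒m%n≡m (toℕ<n a) ⟩
    toℕ a                   ∎)
    where open ≡-Reasoning

  -ₘ-inverseˡ : ∀ a → (-ₘ a) +ₘ a ≡ 0ₘ
  -ₘ-inverseˡ a = toℕ-injective (begin
    toℕ ((-ₘ a) +ₘ a)               ≡⟨ toℕ-mod _ ⟩
    (toℕ (-ₘ a) + toℕ a) % N        ≡⟨ cong (λ x → (x + toℕ a) % N) (toℕ-mod _) ⟩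
    ((N ∸ toℕ a) % N + toℕ a) % N   ≡⟨ [m%N+k]%N≡[m+k]%N _ _ ⟩
    (N ∸ toℕ a + toℕ a) % N         ≡⟨ cong (_% N) (ℕ.m∸n+n≡m (ℕ.<⇒≤ (toℕ<n a))) ⟩
    N % N                           ≡⟨ n%n≡0 N ⟩
    0                               ≡⟨ toℕ-0ₘ ⟨
    toℕ 0ₘ                          ∎)
    where open ≡-Reasoning

  +ₘ-comm : ∀ a b → a +ₘ b ≡ b +ₘ a
  +ₘ-comm a b = cong (_mod N) (ℕ.+-comm (toℕ a) (toℕ b))

ℤ/_ : (N : ℕ) .{{_ : NonZero N}} → AbGroupOn N
ℤ/ N = record
  { _∙_ = _+ₘ_
  ; ε = 0ₘ
  ; _⁻¹ = -ₘ_
  ; isAbGroup = isAbelianGroupˡ +ₘ-assoc +ₘ-identityˡ -ₘ-inverseˡ +ₘ-comm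
  }
  where open Modular N

toℕ-pow : ∀ N .{{_ : NonZero N}} a k → toℕ (pow (ℤ/ N) a k) ≡ (k * toℕ a) % N
toℕ-pow N a zero    = Modular.toℕ-mod N 0
toℕ-pow N a (suc k) = begin
  toℕ (pow (ℤ/ N) a (suc k))                 ≡⟨ toℕ-mod _ ⟩
  (toℕ a + toℕ (pow (ℤ/ N) a k)) % N         ≡⟨ cong (λ x → (toℕ a + x) % N) (toℕ-pow N a k) ⟩
  (toℕ a + (k * toℕ a) % N) % N              ≡⟨ [m+k%N]%N≡[m+k]%N _ _ ⟩
  (toℕ a + k * toℕ a) % N                    ∎
  where open ≡-Reasoning
        open Modular N

abelianGroup : ∀ {n} → AbGroupOn n → AbelianGroup 0ℓ 0ℓ
abelianGroup {n} G = record
  { Carrier = Fin n ; _≈_ = _≡_ ; _∙_ = _∙_ ; ε = ε ; _⁻¹ = _⁻¹ ; isAbelianGroup = isAbGroup }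
  where open AbGroupOn G

record IsHomomorphism {m n} (G : AbGroupOn m) (H : AbGroupOn n) (f : Fin m → Fin n) : Set where
  private
    module G = AbelianGroup (abelianGroup G)
    module H = AbelianGroup (abelianGroup H)
    open AbelianGroupProperties (abelianGroup H) using (identityˡ-unique; inverseˡ-unique)
  field
    ∙-homo : Homomorphic₂ (Fin m) (Fin n) _≡_ f G._∙_ H._∙_

  ε-homo : f G.ε ≡ H.ε
  ε-homo = identityˡ-unique (f G.ε) (f G.ε) (trans (sym (∙-homo G.ε G.ε)) (cong f (G.identityˡ G.ε)))

  ⁻¹-homo : ∀ a → f (a G.⁻¹) ≡ f a H.⁻¹
  ⁻¹-homo a = inverseˡ-unique (f (a G.⁻¹)) (f a)
    (trans (sym (∙-homo (a G.⁻¹) a)) (trans (cong f (G.inverseˡ a)) ε-homo))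

  pow-homo : ∀ a k → f (pow G a k) ≡ pow H (f a) k
  pow-homo a zero    = ε-homo
  pow-homo a (suc k) = trans (∙-homo a (pow G a k)) (cong (f a H.∙_) (pow-homo a k))

relabel : ∀ {n} → AbGroupOn n → Permutation′ n → AbGroupOn n
relabel G π = Transport.transport (AbGroupOn.isAbGroup G) π

module _ {n} (G : AbGroupOn n) (π : Permutation′ n) where

  relabel-homomorphism : IsHomomorphism (relabel G π) G (π ⟨$⟩ʳ_)
  relabel-homomorphism = record { ∙-homo = Transport.to-∙ (AbGroupOn.isAbGroup G) π }

  relabel-isomorphic : Isomorphic G (relabel G π)
  relabel-isomorphic = π ⟨$⟩ˡ_ , Bijection.bijective (Inverse⇒Bijection (Perm.flip π)) , homo
    where
      open AbGroupOn G
      homo : ∀ a b → π ⟨$⟩ˡ (a ∙ b) ≡ π ⟨$⟩ˡ ((π ⟨$⟩ʳ (π ⟨$⟩ˡ a)) ∙ (π ⟨$⟩ʳ (π ⟨$⟩ˡ b)))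
      homo a b = cong (π ⟨$⟩ˡ_) (sym (cong₂ _∙_ (Perm.inverseʳ π) (Perm.inverseʳ π)))

⟨$⟩ʳ-injective : ∀ {n} (π : Permutation′ n) {a b} → π ⟨$⟩ʳ a ≡ π ⟨$⟩ʳ b → a ≡ b
⟨$⟩ʳ-injective π = Injection.injective (Inverse⇒Injection π)

module _ {m k} (G : AbGroupOn m) (H : AbGroupOn k) where
  private
    module G = AbelianGroup (abelianGroup G)
    module H = AbelianGroup (abelianGroup H)

    _·_ : Op₂ (Fin m × Fin k)
    (a , b) · (a′ , b′) = a G.∙ a′ , b H.∙ b′

    ×-isAbelianGroup : IsAbelianGroup _≡_ _·_ (G.ε , H.ε) (λ (a , b) → a G.⁻¹ , b H.⁻¹)
    ×-isAbelianGroup = isAbelianGroupˡ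
      (λ _ _ _ → cong₂ _,_ (G.assoc _ _ _) (H.assoc _ _ _))
      (λ _ → cong₂ _,_ (G.identityˡ _) (H.identityˡ _))
      (λ _ → cong₂ _,_ (G.inverseˡ _) (H.inverseˡ _))
      (λ _ _ → cong₂ _,_ (G.comm _ _) (H.comm _ _))

  infixr 7 _⊗_
  _⊗_ : AbGroupOn (m * k)
  _⊗_ = Transport.transport ×-isAbelianGroup *↔×

  open Transport ×-isAbelianGroup *↔× using (to-∙; from-∙)

  ⊗-inj₂ : Fin k → Fin (m * k)
  ⊗-inj₂ b = combine G.ε b

  ⊗-inj₂-homomorphism : IsHomomorphism H _⊗_ ⊗-inj₂
  ⊗-inj₂-homomorphism = record { ∙-homo = homo }
    where
      open ≡-Reasoning
      homo : ∀ b b′ → ⊗-inj₂ (b H.∙ b′) ≡ AbGroupOn._∙_ _⊗_ (⊗-inj₂ b) (⊗-inj₂ b′)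
      homo b b′ = begin
        combine G.ε (b H.∙ b′)                   ≡⟨ cong (λ a → combine a (b H.∙ b′)) (G.identityˡ G.ε) ⟨
        uncurry combine ((G.ε , b) · (G.ε , b′)) ≡⟨ from-∙ (G.ε , b) (G.ε , b′) ⟩
        AbGroupOn._∙_ _⊗_ (⊗-inj₂ b) (⊗-inj₂ b′) ∎

  ⊗-inj₂-injective : ∀ {b b′} → ⊗-inj₂ b ≡ ⊗-inj₂ b′ → b ≡ b′
  ⊗-inj₂-injective {b} {b′} eq = cong proj₂ (begin
    (G.ε , b)                 ≡⟨ remQuot-combine G.ε b ⟨
    remQuot {m} k (⊗-inj₂ b)  ≡⟨ cong (remQuot {m} k) eq ⟩
    remQuot {m} k (⊗-inj₂ b′) ≡⟨ remQuot-combine G.ε b′ ⟩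
    (G.ε , b′)                ∎)
    where open ≡-Reasoning

  ⊗-proj₁-homomorphism : IsHomomorphism _⊗_ G (proj₁ ∘ remQuot {m} k)
  ⊗-proj₁-homomorphism = record { ∙-homo = λ a b → cong proj₁ (to-∙ a b) }

  ⊗-proj₂-homomorphism : IsHomomorphism _⊗_ H (proj₂ ∘ remQuot {m} k)
  ⊗-proj₂-homomorphism = record { ∙-homo = λ a b → cong proj₂ (to-∙ a b) }

HasExponent : ∀ {n} → AbGroupOn n → ℕ → Set
HasExponent G d = ∀ a → pow G a d ≡ AbGroupOn.ε G

ℤ/-hasExponent : ∀ N .{{_ : NonZero N}} {d} → N ∣ d → HasExponent (ℤ/ N) d
ℤ/-hasExponent N {d} N∣d a = toℕ-injective (begin
  toℕ (pow (ℤ/ N) a d)   ≡⟨ toℕ-pow N a d ⟩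
  (d * toℕ a) % N        ≡⟨ n∣m⇒m%n≡0 _ N (∣-trans N∣d (m∣m*n (toℕ a))) ⟩
  0                      ≡⟨ Modular.toℕ-0ₘ N ⟨
  toℕ (Modular.0ₘ N)     ∎)
  where open ≡-Reasoning

⊗-hasExponent : ∀ {m k d} {G : AbGroupOn m} {H : AbGroupOn k} →
                HasExponent G d → HasExponent H d → HasExponent (G ⊗ H) d
⊗-hasExponent {m} {k} {d} {G} {H} expG expH a = begin
  pow (G ⊗ H) a d                               ≡⟨ combine-remQuot {m} k _ ⟨
  uncurry combine (remQuot {m} k (pow (G ⊗ H) a d)) ≡⟨ cong (uncurry combine) (cong₂ _,_ (component (⊗-proj₁-homomorphism G H) expG)
                                                                                  (component (⊗-proj₂-homomorphism G H) expH)) ⟩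
  uncurry combine (remQuot {m} k ε)             ≡⟨ combine-remQuot {m} k _ ⟩
  ε                                             ∎
  where
    open ≡-Reasoning
    open AbGroupOn (G ⊗ H) using (ε)
    component : ∀ {l} {F : AbGroupOn l} {p : Fin (m * k) → Fin l} → IsHomomorphism (G ⊗ H) F p →
                HasExponent F d → p (pow (G ⊗ H) a d) ≡ p ε
    component p-homo expF = trans (pow-homo a d) (trans (expF _) (sym ε-homo))
      where open IsHomomorphism p-homo

injectiveHomomorphism-hasExponent : ∀ {m n d} {G : AbGroupOn m} {H : AbGroupOn n} {f : Fin m → Fin n} →
  IsHomomorphism G H f → (∀ {a b} → f a ≡ f b → a ≡ b) → HasExponent H d → HasExponent G d
injectiveHomomorphism-hasExponent {d = d} {G} {H} {f} f-homo f-injective expH a =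
  f-injective (trans (pow-homo a d) (trans (expH (f a)) (sym ε-homo)))
  where open IsHomomorphism f-homo

relabel-hasExponent : ∀ {n d} (G : AbGroupOn n) (π : Permutation′ n) → HasExponent G d → HasExponent (relabel G π) d
relabel-hasExponent {d = d} G π = injectiveHomomorphism-hasExponent {d = d} (relabel-homomorphism G π) (⟨$⟩ʳ-injective π)

isomorphic-hasExponent : ∀ {n d} {G H : AbGroupOn n} → Isomorphic G H → HasExponent H d → HasExponent G d
isomorphic-hasExponent {d = d} (f , (f-injective , _) , ∙-homo) =
  injectiveHomomorphism-hasExponent {d = d} (record { ∙-homo = ∙-homo }) f-injective

-- Subgroups, bases and presentations

record IsSubgroup {n} (G : AbGroupOn n) (S : Fin n → Set) : Set where
  open AbGroupOn G
  field
    ∙-closed  : ∀ {a b} → S a → S b → S (a ∙ b)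
    ε-closed  : S ε
    ⁻¹-closed : ∀ {a} → S a → S (a ⁻¹)

  pow-closed : ∀ {a} k → S a → S (pow G a k)
  pow-closed zero    _  = ε-closed
  pow-closed (suc k) Sa = ∙-closed Sa (pow-closed k Sa)

  zpow-closed : ∀ {a} z → S a → S (zpow G a z)
  zpow-closed (+ k)    Sa = pow-closed k Sa
  zpow-closed -[1+ k ] Sa = ⁻¹-closed (pow-closed (suc k) Sa)

  prod-closed : ∀ {as} → All S as → S (prod G as)
  prod-closed []         = ε-closed
  prod-closed (Sa ∷ Sas) = ∙-closed Sa (prod-closed Sas)

  evalWord-closed : ∀ {gs} → All S gs → ∀ v → S (evalWord G (fromList gs) v)
  evalWord-closed []         []      = ε-closed
  evalWord-closed (Sg ∷ Sgs) (z ∷ v) = ∙-closed (zpow-closed z Sg) (evalWord-closed Sgs v)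

module _ {m n} {G : AbGroupOn m} {H : AbGroupOn n} {f : Fin m → Fin n}
         (f-homo : IsHomomorphism G H f) where
  private
    module G = AbGroupOn G
    module H = AbGroupOn H
  open IsHomomorphism f-homo

  image-isSubgroup : IsSubgroup H (λ b → ∃ λ a → b ≡ f a)
  image-isSubgroup = record
    { ∙-closed  = λ (a , b≡fa) (a′ , b′≡fa′) → a G.∙ a′ , trans (cong₂ H._∙_ b≡fa b′≡fa′) (sym (∙-homo a a′))
    ; ε-closed  = G.ε , sym ε-homo
    ; ⁻¹-closed = λ (a , b≡fa) → a G.⁻¹ , trans (cong H._⁻¹ b≡fa) (sym (⁻¹-homo a))
    }

  preimage-isSubgroup : ∀ {S} → IsSubgroup H S → IsSubgroup G (S ∘ f)
  preimage-isSubgroup {S} S-subgroup = record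
    { ∙-closed  = λ {a} {b} Sfa Sfb → subst S (sym (∙-homo a b)) (∙-closed Sfa Sfb)
    ; ε-closed  = subst S (sym ε-homo) ε-closed
    ; ⁻¹-closed = λ {a} Sfa → subst S (sym (⁻¹-homo a)) (⁻¹-closed Sfa)
    }
    where open IsSubgroup S-subgroup

module _ {n} {G : AbGroupOn n} {S : Fin n → Set} (S-subgroup : IsSubgroup G S) where
  open IsSubgroup S-subgroup

  basis-generates : ∀ {as} → IsBasis G as → All S as → ∀ g → S g
  basis-generates (_ , decompose) Sas g with decompose g
  ... | xs , (xs∈⟨as⟩ , prod≡g) , _ = subst S prod≡g (prod-closed (powers xs∈⟨as⟩ Sas))
    where
      powers : ∀ {xs as} → Pointwise (InCyclic G) xs as → All S as → All S xs
      powers []                    []         = []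
      powers ((k , refl) ∷ xs∈⟨as⟩) (Sa ∷ Sas) = pow-closed k Sa ∷ powers xs∈⟨as⟩ Sas

  presentation-generates : ∀ {gs rs} → Presents G (gs , rs) → All S gs → ∀ g → S g
  presentation-generates (generates , _) Sgs g with generates g
  ... | v , eval≡g = subst S eval≡g (evalWord-closed Sgs v)

module _ {n} (G : AbGroupOn n) where
  open AbGroupOn G
  open IsAbelianGroup isAbGroup using (identityˡ; identityʳ)

  private
    εs : List (Fin n) → List (Fin n)
    εs = List.map (λ _ → ε)

    εs-inCyclic : ∀ as → Pointwise (InCyclic G) (εs as) as
    εs-inCyclic []       = []
    εs-inCyclic (_ ∷ as) = (0 , refl) ∷ εs-inCyclic as

    prod-εs : ∀ as → prod G (εs as) ≡ ε
    prod-εs []       = refl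
    prod-εs (_ ∷ as) = trans (identityˡ _) (prod-εs as)

    prod-εs-++ : ∀ as xs → prod G (εs as ++ xs) ≡ prod G xs
    prod-εs-++ []       xs = refl
    prod-εs-++ (_ ∷ as) xs = trans (identityˡ _) (prod-εs-++ as xs)

  -- x has two decompositions along the basis: itself in its own slot, or as a power of y in y's slot.
  IsBasis⇒¬InCyclic : ∀ as x bs y cs → IsBasis G (as ++ x ∷ bs ++ y ∷ cs) → ¬ InCyclic G x y
  IsBasis⇒¬InCyclic as x bs y cs (orders , decompose) (k , x≡yᵏ) with decompose x
  ... | _ , _ , unique = x≢ε (∷-injectiveˡ (++-cancelˡ (εs as) _ _ (trans (unique xs₁ xs₁∈ prod₁) (sym (unique xs₂ xs₂∈ prod₂)))))
    where
      xs₁ = εs as ++ x ∷ εs bs ++ ε ∷ εs cs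
      xs₂ = εs as ++ ε ∷ εs bs ++ x ∷ εs cs

      xs₁∈ : Pointwise (InCyclic G) xs₁ (as ++ x ∷ bs ++ y ∷ cs)
      xs₁∈ = Pointwise.++⁺ (εs-inCyclic as) ((1 , sym (identityʳ x)) ∷ Pointwise.++⁺ (εs-inCyclic bs) ((0 , refl) ∷ εs-inCyclic cs))

      xs₂∈ : Pointwise (InCyclic G) xs₂ (as ++ x ∷ bs ++ y ∷ cs)
      xs₂∈ = Pointwise.++⁺ (εs-inCyclic as) ((0 , refl) ∷ Pointwise.++⁺ (εs-inCyclic bs) ((k , x≡yᵏ) ∷ εs-inCyclic cs))

      prod₁ : prod G xs₁ ≡ x
      prod₁ = begin
        prod G xs₁                          ≡⟨ prod-εs-++ as _ ⟩
        x ∙ prod G (εs bs ++ ε ∷ εs cs)     ≡⟨ cong (x ∙_) (prod-εs-++ bs _) ⟩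
        x ∙ (ε ∙ prod G (εs cs))            ≡⟨ cong (x ∙_) (trans (identityˡ _) (prod-εs cs)) ⟩
        x ∙ ε                               ≡⟨ identityʳ x ⟩
        x                                   ∎
        where open ≡-Reasoning

      prod₂ : prod G xs₂ ≡ x
      prod₂ = begin
        prod G xs₂                          ≡⟨ prod-εs-++ as _ ⟩
        ε ∙ prod G (εs bs ++ x ∷ εs cs)     ≡⟨ identityˡ _ ⟩
        prod G (εs bs ++ x ∷ εs cs)         ≡⟨ prod-εs-++ bs _ ⟩
        x ∙ prod G (εs cs)                  ≡⟨ cong (x ∙_) (prod-εs cs) ⟩
        x ∙ ε                               ≡⟨ identityʳ x ⟩
        x                                   ∎
        where open ≡-Reasoning

      x≢ε : x ≢ ε
      x≢ε x≡ε with All.++⁻ʳ as orders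
      ... | x¹≢ε ∷ _ = x¹≢ε (trans (identityʳ x) x≡ε)

-- Partial injections and permutations

∃-∉ : ∀ {m} (xs : List (Fin m)) → length xs < m → ∃ λ x → x ∉ xs
∃-∉ {m} xs |xs|<m = ¬∀⟶∃¬ m (_∈ xs) (_∈? xs) ¬all∈
  where
    open import Data.List.Membership.DecPropositional (_≟_ {m}) using (_∈?_)
    ¬all∈ : ¬ (∀ x → x ∈ xs)
    ¬all∈ all∈ with pigeonhole |xs|<m (λ x → Any.index (all∈ x))
    ... | i , j , i<j , same-index = <⇒≢ i<j (begin
      i                                   ≡⟨ lookup-index (all∈ i) ⟩
      List.lookup xs (Any.index (all∈ i)) ≡⟨ cong (List.lookup xs) same-index ⟩
      List.lookup xs (Any.index (all∈ j)) ≡⟨ lookup-index (all∈ j) ⟨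
      j                                   ∎)
      where open ≡-Reasoning

data IsPartialInjection {A B : Set} : List (A × B) → Set where
  []   : IsPartialInjection []
  cons : ∀ {a b P} → a ∉ List.map proj₁ P → b ∉ List.map proj₂ P →
         IsPartialInjection P → IsPartialInjection ((a , b) ∷ P)

module _ {A B C : Set} {f : B → C} where

  dom-map₂ : (P : List (A × B)) → List.map proj₁ (List.map (map₂ f) P) ≡ List.map proj₁ P
  dom-map₂ P = sym (map-∘ P)

  cod-map₂ : (P : List (A × B)) → List.map proj₂ (List.map (map₂ f) P) ≡ List.map f (List.map proj₂ P)
  cod-map₂ P = trans (sym (map-∘ P)) (map-∘ P)

  map₂-isPartialInjection : (∀ {b b′} → f b ≡ f b′ → b ≡ b′) →
    ∀ {P : List (A × B)} → IsPartialInjection P → IsPartialInjection (List.map (map₂ f) P)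
  map₂-isPartialInjection f-injective [] = []
  map₂-isPartialInjection f-injective (cons {a} {b} {P} a∉ b∉ P-inj) =
    cons (a∉ ∘ subst (a ∈_) (dom-map₂ P))
         (b∉ ∘ ∈-map-injective ∘ subst (f b ∈_) (cod-map₂ P))
         (map₂-isPartialInjection f-injective P-inj)
    where
      ∈-map-injective : ∀ {bs} → f b ∈ List.map f bs → b ∈ bs
      ∈-map-injective fb∈ with ∈-map⁻ f fb∈
      ... | _ , b′∈ , fb≡fb′ = subst (_∈ _) (sym (f-injective fb≡fb′)) b′∈

transpose-matchˡ : ∀ {n} (i j : Fin n) → PC.transpose i j i ≡ j
transpose-matchˡ i j rewrite dec-true (i ≟ i) refl = refl

transpose-other : ∀ {n} {i j k : Fin n} → k ≢ i → k ≢ j → PC.transpose i j k ≡ k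
transpose-other {i = i} {j} {k} k≢i k≢j rewrite dec-false (k ≟ i) k≢i | dec-false (k ≟ j) k≢j = refl

Realises : ∀ {n} → Permutation′ n → List (Fin n × Fin n) → Set
Realises π = All (λ (a , b) → π ⟨$⟩ʳ a ≡ b)

-- Extend one pair at a time, correcting the image of the new point by a transposition.
isPartialInjection⇒permutation : ∀ {n} {P : List (Fin n × Fin n)} → IsPartialInjection P → ∃ λ π → Realises π P
isPartialInjection⇒permutation [] = Perm.id , []
isPartialInjection⇒permutation (cons {a} {b} {P} a∉ b∉ P-inj) with isPartialInjection⇒permutation P-inj
... | π , π-realises = π Perm.∘ₚ Perm.transpose (π ⟨$⟩ʳ a) b , transpose-matchˡ (π ⟨$⟩ʳ a) b ∷ untouched a∉ b∉ π-realises
  where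
    untouched : ∀ {Q} → a ∉ List.map proj₁ Q → b ∉ List.map proj₂ Q → Realises π Q →
                Realises (π Perm.∘ₚ Perm.transpose (π ⟨$⟩ʳ a) b) Q
    untouched {[]} _ _ [] = []
    untouched {(a′ , b′) ∷ Q} a∉ b∉ (πa′≡b′ ∷ rest) =
      trans (cong (PC.transpose _ b) πa′≡b′)
            (transpose-other (λ b′≡πa → a∉ (here (sym (⟨$⟩ʳ-injective π (trans πa′≡b′ b′≡πa)))))
                             (λ b′≡b → b∉ (here (sym b′≡b))))
      ∷ untouched (a∉ ∘ there) (b∉ ∘ there) rest

-- Query trees

module _ {Q A O : Set} where

  data Verdict (T : Tree Q A O) (f : ℕ) (Admissible : (Q → A) → Set) : Set where
    halts : (o : O) → (∀ {orc} → Admissible orc → run T orc ≡ o) → Verdict T f Admissible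
    slow  : (∀ {orc} → Admissible orc → f ≤ cost T orc) → Verdict T f Admissible

  verdict-ask : ∀ {q k a f} {Admissible : (Q → A) → Set} →
                (∀ {orc} → Admissible orc → orc q ≡ a) →
                Verdict (k a) f Admissible → Verdict (ask q k) (suc f) Admissible
  verdict-ask {k = k} answers (halts o runs) =
    halts o λ {orc} adm → trans (cong (λ a → run (k a) orc) (answers adm)) (runs adm)
  verdict-ask {k = k} {f = f} answers (slow bound) =
    slow λ {orc} adm → s≤s (subst (λ a → f ≤ cost (k a) orc) (sym (answers adm)) (bound adm))

module _ {n : ℕ} {O : Set} (G : AbGroupOn n) where

  answerFirstGroup : Tree (Bool × Fin n × Fin n) (Fin n) O → Tree (Fin n × Fin n) (Fin n) O
  answerFirstGroup (leaf o)            = leaf o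
  answerFirstGroup (ask (true , q) k)  = answerFirstGroup (k (table G q))
  answerFirstGroup (ask (false , q) k) = ask q (λ a → answerFirstGroup (k a))

  run-answerFirstGroup : ∀ H T → run (answerFirstGroup T) (table H) ≡ run T (table₂ G H)
  run-answerFirstGroup H (leaf o)            = refl
  run-answerFirstGroup H (ask (true , q) k)  = run-answerFirstGroup H (k (table G q))
  run-answerFirstGroup H (ask (false , q) k) = run-answerFirstGroup H (k (table H q))

  cost-answerFirstGroup : ∀ H T → cost (answerFirstGroup T) (table H) ≤ cost T (table₂ G H)
  cost-answerFirstGroup H (leaf o)            = z≤n
  cost-answerFirstGroup H (ask (true , q) k)  = ℕ.m≤n⇒m≤1+n (cost-answerFirstGroup H (k (table G q)))
  cost-answerFirstGroup H (ask (false , q) k) = s≤s (cost-answerFirstGroup H (k (table H q)))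

-- The adversary

module Adversary {n M : ℕ} (M≤n : M ≤ n) (H : AbGroupOn M) where
  open AbGroupOn H using () renaming (_∙_ to _⊕_)
  open import Data.List.Membership.DecPropositional (_≟_ {n}) using () renaming (_∈?_ to _∈ₙ?_)
  open import Data.List.Membership.DecPropositional (_≟_ {M}) using () renaming (_∈?_ to _∈ₘ?_)

  Labelling : Set
  Labelling = List (Fin n × Fin M)

  dom : Labelling → List (Fin n)
  dom = List.map proj₁

  ∈-dom⁻ : ∀ {a P} → a ∈ dom P → ∃ λ i → (a , i) ∈ P
  ∈-dom⁻ a∈ with ∈-map⁻ proj₁ a∈
  ... | (_ , i) , a↦i , refl = i , a↦i

  record Extension (P : Labelling) (k : ℕ) : Set where
    field
      labelling          : Labelling
      isPartialInjection : IsPartialInjection labelling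
      extends            : P ⊆ labelling
      size               : length labelling ≤ length P + k
  open Extension

  unchanged : ∀ {P k} → IsPartialInjection P → Extension P k
  unchanged {P} {k} P-inj = record
    { labelling = P ; isPartialInjection = P-inj ; extends = λ x∈ → x∈ ; size = ℕ.m≤m+n (length P) k }

  _⨾_ : ∀ {P k l} (E : Extension P k) → Extension (labelling E) l → Extension P (k + l)
  _⨾_ {P} {k} {l} E E′ = record
    { labelling          = labelling E′
    ; isPartialInjection = isPartialInjection E′
    ; extends            = extends E′ ∘ extends E
    ; size               = ℕ.≤-trans (size E′) (ℕ.≤-trans (ℕ.+-monoˡ-≤ l (size E))
                                                          (ℕ.≤-reflexive (ℕ.+-assoc (length P) k l)))
    }

  assign : ∀ P → IsPartialInjection P → length P < M → (a : Fin n) →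
           Σ[ E ∈ Extension P 1 ] ∃ λ i → (a , i) ∈ labelling E
  assign P P-inj |P|<M a with a ∈ₙ? dom P
  ... | yes a∈ = unchanged P-inj , ∈-dom⁻ a∈
  ... | no a∉ with ∃-∉ (List.map proj₂ P) (subst (_< M) (sym (length-map proj₂ P)) |P|<M)
  ...   | i , i∉ = record { labelling = (a , i) ∷ P ; isPartialInjection = cons a∉ i∉ P-inj
                          ; extends = there ; size = ℕ.≤-reflexive (ℕ.+-comm 1 (length P)) }
                 , i , here refl

  label : ∀ P → IsPartialInjection P → length P < n → (i : Fin M) →
          Σ[ E ∈ Extension P 1 ] ∃ λ c → (c , i) ∈ labelling E
  label P P-inj |P|<n i with i ∈ₘ? List.map proj₂ P
  ... | yes i∈ with ∈-map⁻ proj₂ i∈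
  ...   | (c , _) , c↦i , refl = unchanged P-inj , c , c↦i
  label P P-inj |P|<n i | no i∉ with ∃-∉ (dom P) (subst (_< n) (sym (length-map proj₁ P)) |P|<n)
  ...   | c , c∉ = record { labelling = (c , i) ∷ P ; isPartialInjection = cons c∉ i∉ P-inj
                          ; extends = there ; size = ℕ.≤-reflexive (ℕ.+-comm 1 (length P)) }
                 , c , here refl

  room⇒< : ∀ (P : Labelling) {r} → length P + suc r ≤ M → length P < M
  room⇒< P room = ℕ.<-≤-trans (ℕ.m<m+n (length P) (s≤s z≤n)) room

  room-after : ∀ {P : Labelling} {k r} (E : Extension P k) → length P + (k + r) ≤ M → length (labelling E) + r ≤ M
  room-after {P} {k} {r} E room =
    ℕ.≤-trans (ℕ.+-monoˡ-≤ r (size E)) (ℕ.≤-trans (ℕ.≤-reflexive (ℕ.+-assoc (length P) k r)) room)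

  record Answer (P : Labelling) (a b : Fin n) : Set where
    field
      extension : Extension P 3
      product   : Fin n
      i j       : Fin M
      a↦i       : (a , i) ∈ labelling extension
      b↦j       : (b , j) ∈ labelling extension
      product↦  : (product , i ⊕ j) ∈ labelling extension

  answer : ∀ P → IsPartialInjection P → length P + 3 ≤ M → (a b : Fin n) → Answer P a b
  answer P P-inj room a b = record
    { extension = E₁ ⨾ (E₂ ⨾ E₃)
    ; product   = c
    ; i = i ; j = j
    ; a↦i = extends E₃ (extends E₂ a↦i)
    ; b↦j = extends E₃ b↦j
    ; product↦ = c↦i⊕j
    }
    where
      a-assigned = assign P P-inj (room⇒< P room) a
      E₁ = proj₁ a-assigned
      i = proj₁ (proj₂ a-assigned)
      a↦i = proj₂ (proj₂ a-assigned)

      b-assigned = assign (labelling E₁) (isPartialInjection E₁) (room⇒< (labelling E₁) (room-after E₁ room)) b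
      E₂ = proj₁ b-assigned
      j = proj₁ (proj₂ b-assigned)
      b↦j = proj₂ (proj₂ b-assigned)

      |P₂|<n : length (labelling E₂) < n
      |P₂|<n = ℕ.<-≤-trans (room⇒< (labelling E₂) (room-after E₂ (room-after E₁ room))) M≤n

      product-labelled = label (labelling E₂) (isPartialInjection E₂) |P₂|<n (i ⊕ j)
      E₃ = proj₁ product-labelled
      c = proj₁ (proj₂ product-labelled)
      c↦i⊕j = proj₂ (proj₂ product-labelled)

  Respects : (Fin n × Fin n → Fin n) → Labelling → Set
  Respects t P = ∀ {a b c i j} → (a , i) ∈ P → (b , j) ∈ P → (c , i ⊕ j) ∈ P → t (a , b) ≡ c

  play : ∀ {O} f (T : Tree (Fin n × Fin n) (Fin n) O) P → IsPartialInjection P → length P + f * 3 ≤ M →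
         Σ[ E ∈ Extension P (f * 3) ] Verdict T f (λ t → Respects t (labelling E))
  play f       (leaf o)        P P-inj room = unchanged P-inj , halts o λ _ → refl
  play zero    (ask q k)       P P-inj room = unchanged P-inj , slow λ _ → z≤n
  play (suc f) (ask (a , b) k) P P-inj room with answer P P-inj (ℕ.≤-trans (ℕ.+-monoʳ-≤ (length P) (ℕ.m≤m+n 3 (f * 3))) room) a b
  ... | A with play f (k (Answer.product A)) (labelling (Answer.extension A)) (isPartialInjection (Answer.extension A))
                    (room-after (Answer.extension A) room)
  ...   | E , verdict = Answer.extension A ⨾ E ,
          verdict-ask (λ respects → respects (extends E (Answer.a↦i A)) (extends E (Answer.b↦j A))
                                               (extends E (Answer.product↦ A)))
                      verdict

  assignAll : ∀ P → IsPartialInjection P → (as : List (Fin n)) → length P + length as ≤ M →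
              Σ[ E ∈ Extension P (length as) ] All (_∈ dom (labelling E)) as
  assignAll P P-inj []       room = unchanged P-inj , []
  assignAll P P-inj (a ∷ as) room with assign P P-inj (room⇒< P room) a
  ... | E₁ , i , a↦i with assignAll (labelling E₁) (isPartialInjection E₁) as (room-after E₁ room)
  ...   | E , as∈ = E₁ ⨾ E , ∈-map⁺ proj₁ (extends E a↦i) ∷ as∈

  respects-⊆ : ∀ {t P P′} → P ⊆ P′ → Respects t P′ → Respects t P
  respects-⊆ P⊆P′ respects a↦i b↦j c↦ = respects (P⊆P′ a↦i) (P⊆P′ b↦j) (P⊆P′ c↦)

  module Realisation {G : AbGroupOn n} {ι : Fin M → Fin n}
                     (ι-homo : IsHomomorphism H G ι) (ι-injective : ∀ {i j} → ι i ≡ ι j → i ≡ j) where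
    open AbGroupOn G using (_∙_)
    open IsHomomorphism ι-homo using (∙-homo)

    image : Labelling → List (Fin n × Fin n)
    image = List.map (map₂ ι)

    realise : ∀ {P} → IsPartialInjection P → ∃ λ π → Realises π (image P)
    realise P-inj = isPartialInjection⇒permutation (map₂-isPartialInjection ι-injective P-inj)

    realises⇒↦ : ∀ {π P a i} → Realises π (image P) → (a , i) ∈ P → π ⟨$⟩ʳ a ≡ ι i
    realises⇒↦ realises a↦i = All.lookup realises (∈-map⁺ (map₂ ι) a↦i)

    realises⇒respects : ∀ {π P} → Realises π (image P) → Respects (table (relabel G π)) P
    realises⇒respects {π} {P} realises {a} {b} {c} {i} {j} a↦i b↦j c↦ = begin
      π ⟨$⟩ˡ ((π ⟨$⟩ʳ a) ∙ (π ⟨$⟩ʳ b)) ≡⟨ cong (π ⟨$⟩ˡ_) (cong₂ _∙_ (↦ a↦i) (↦ b↦j)) ⟩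
      π ⟨$⟩ˡ (ι i ∙ ι j)             ≡⟨ cong (π ⟨$⟩ˡ_) (∙-homo i j) ⟨
      π ⟨$⟩ˡ ι (i ⊕ j)               ≡⟨ cong (π ⟨$⟩ˡ_) (↦ c↦) ⟨
      π ⟨$⟩ˡ (π ⟨$⟩ʳ c)              ≡⟨ Perm.inverseˡ π ⟩
      c                             ∎
      where
        open ≡-Reasoning
        ↦ : ∀ {a i} → (a , i) ∈ P → π ⟨$⟩ʳ a ≡ ι i
        ↦ = realises⇒↦ {π} {P} realises

    Confined : Permutation′ n → Fin n → Set
    Confined π a = ∃ λ i → π ⟨$⟩ʳ a ≡ ι i

    confined-isSubgroup : ∀ π → IsSubgroup (relabel G π) (Confined π)
    confined-isSubgroup π = preimage-isSubgroup (relabel-homomorphism G π) (image-isSubgroup ι-homo)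

    record Confinement (P : Labelling) (as : List (Fin n)) : Set where
      field
        π        : Permutation′ n
        respects : Respects (table (relabel G π)) P
        confines : All (Confined π) (as ++ dom P)

    confine : ∀ {P} → IsPartialInjection P → (as : List (Fin n)) → length P + length as ≤ M → Confinement P as
    confine {P} P-inj as room with assignAll P P-inj as room
    ... | E , as∈ with realise (isPartialInjection E)
    ...   | π , realises = record
      { π        = π
      ; respects = respects-⊆ (extends E) (realises⇒respects {π} {labelling E} realises)
      ; confines = All.++⁺ (All.map labelled as∈) (All.tabulate (λ a∈ → labelled (domain-grows a∈)))
      }
      where
        labelled : ∀ {a} → a ∈ dom (labelling E) → Confined π a
        labelled a∈ = let (i , a↦i) = ∈-dom⁻ a∈ in i , realises⇒↦ {π} {labelling E} realises a↦i

        domain-grows : ∀ {a} → a ∈ dom P → a ∈ dom (labelling E)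
        domain-grows a∈ = ∈-map⁺ proj₁ (extends E (proj₂ (∈-dom⁻ {P = P} a∈)))

-- Lower bounds

2*m≢1+2*n : ∀ m n → 2 * m ≢ suc (2 * n)
2*m≢1+2*n m n eq = 2≢1 (∣1⇒≡1 (∣m+n∣m⇒∣n (subst (2 ∣_) (trans eq (ℕ.+-comm 1 (2 * n))) (m∣m*n m)) (m∣m*n n)))
  where
    2≢1 : 2 ≢ 1
    2≢1 ()

module _ {A : Set} (_≟ᴬ_ : DecidableEquality A) where
  open import Data.List.Membership.DecPropositional _≟ᴬ_ using (_∈?_)

  data Outsiders (D : List A) : List A → Set where
    two       : ∀ as u bs v cs → u ∉ D → v ∉ D → Outsiders D (as ++ u ∷ bs ++ v ∷ cs)
    atMostOne : ∀ {L} os → length os ≤ 1 → All (_∈ os ++ D) L → Outsiders D L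

  outsiders : ∀ D L → Outsiders D L
  outsiders D L with first (λ x → toSum (x ∈? D)) L
  ... | inj₂ L⊆D = atMostOne [] z≤n L⊆D
  ... | inj₁ first-out with toView first-out
  ...   | First._++_∷_ {as} {u} as⊆D u∉ L′ with first (λ x → toSum (x ∈? D)) L′
  ...     | inj₂ L′⊆D = atMostOne (u ∷ []) ℕ.≤-refl (All.++⁺ (All.map there as⊆D) (here refl ∷ All.map there L′⊆D))
  ...     | inj₁ second-out with toView second-out
  ...       | First._++_∷_ {bs} {v} _ v∉ cs = two as u bs v cs u∉ v∉

square-bound : ∀ {s K} → 8 ≤ K → s ^ 2 ≤ 8 * K → s ≤ K
square-bound {s} {K} 8≤K s²≤8K with s ℕ.≤? K
... | yes s≤K = s≤K
... | no s≰K = contradiction s²≤8K (ℕ.<⇒≱ (begin-strict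
  8 * K  ≤⟨ ℕ.*-monoˡ-≤ K 8≤K ⟩
  K * K  <⟨ ℕ.*-mono-< (ℕ.≰⇒> s≰K) (ℕ.≰⇒> s≰K) ⟩
  s * s  ≡⟨ cong (s *_) (ℕ.*-identityʳ s) ⟨
  s ^ 2  ∎))
  where open ℕ.≤-Reasoning

module LowerBounds (k : ℕ) where

  -- Each answered query matches at most three new labels, so K queries use 3K of the
  -- M = 4K elements of the subgroup and leave K for the labels of a short output.
  K M n : ℕ
  K = suc k
  M = 4 * K
  n = 2 * M

  M<n : M < n
  M<n = ℕ.m<m+n M (s≤s z≤n)

  n≡8*K : n ≡ 8 * K
  n≡8*K = sym (ℕ.*-assoc 2 4 K)

  8≤n : 8 ≤ n
  8≤n = subst (8 ≤_) (sym n≡8*K) (ℕ.*-monoʳ-≤ 8 (s≤s z≤n))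

  k≤n : k ≤ n
  k≤n = subst (k ≤_) (sym n≡8*K) (ℕ.≤-trans (ℕ.n≤1+n k) (ℕ.m≤n*m K 8))

  n≤8* : ∀ {c} → K ≤ c → n ≤ 8 * c
  n≤8* {c} K≤c = subst (_≤ 8 * c) (sym n≡8*K) (ℕ.*-monoʳ-≤ 8 K≤c)

  K*3+K≡M : K * 3 + K ≡ M
  K*3+K≡M = trans (ℕ.+-comm (K * 3) K) (trans (sym (ℕ.*-suc K 3)) (ℕ.*-comm K 4))

  room : ∀ {a b} → a ≤ K * 3 → b ≤ K → a + b ≤ M
  room {a} {b} a≤ b≤ = subst (a + b ≤_) K*3+K≡M (ℕ.+-mono-≤ a≤ b≤)

  ℤₙ : AbGroupOn n
  ℤₙ = ℤ/ n

  double : Fin M → Fin n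
  double i = fromℕ< (ℕ.*-monoʳ-< 2 (toℕ<n i))

  toℕ-double : ∀ i → toℕ (double i) ≡ 2 * toℕ i
  toℕ-double i = toℕ-fromℕ< _

  double-homomorphism : IsHomomorphism (ℤ/ M) ℤₙ double
  double-homomorphism = record { ∙-homo = λ i j → toℕ-injective (begin
    toℕ (double (i +ₘ j))                         ≡⟨ toℕ-double (i +ₘ j) ⟩
    2 * toℕ (i +ₘ j)                              ≡⟨ cong (2 *_) (Modular.toℕ-mod M (toℕ i + toℕ j)) ⟩
    2 * ((toℕ i + toℕ j) % M)                     ≡⟨ ℕ.*-comm 2 ((toℕ i + toℕ j) % M) ⟩
    (toℕ i + toℕ j) % M * 2                       ≡⟨ m%n*o≡m*o%[n*o] (toℕ i + toℕ j) M 2 ⟩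
    (toℕ i + toℕ j) * 2 % (M * 2)                 ≡⟨ %-congʳ {o = (toℕ i + toℕ j) * 2} (ℕ.*-comm M 2) ⟩
    (toℕ i + toℕ j) * 2 % n                       ≡⟨ cong (_% n) (ℕ.*-distribʳ-+ 2 (toℕ i) (toℕ j)) ⟩
    (toℕ i * 2 + toℕ j * 2) % n                   ≡⟨ cong₂ (λ x y → (x + y) % n) (ℕ.*-comm (toℕ i) 2) (ℕ.*-comm (toℕ j) 2) ⟩
    (2 * toℕ i + 2 * toℕ j) % n                   ≡⟨ cong₂ (λ x y → (x + y) % n) (toℕ-double i) (toℕ-double j) ⟨
    (toℕ (double i) + toℕ (double j)) % n         ≡⟨ Modular.toℕ-mod n (toℕ (double i) + toℕ (double j)) ⟨
    toℕ (AbGroupOn._∙_ ℤₙ (double i) (double j))  ∎) }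
    where
      open ≡-Reasoning
      open Modular M using (_+ₘ_)

  double-injective : ∀ {i j} → double i ≡ double j → i ≡ j
  double-injective {i} {j} eq = toℕ-injective (ℕ.*-cancelˡ-≡ (toℕ i) (toℕ j) 2
    (trans (sym (toℕ-double i)) (trans (cong toℕ eq) (toℕ-double j))))

  odd≢double : ∀ {a} m i → toℕ a ≡ suc (2 * m) → a ≢ double i
  odd≢double m i a-odd a≡double = 2*m≢1+2*n (toℕ i) m (trans (sym (toℕ-double i)) (trans (cong toℕ (sym a≡double)) a-odd))

  3<n : 3 < n
  3<n = ℕ.≤-trans (s≤s (s≤s (s≤s (s≤s z≤n)))) 8≤n

  one three : Fin n
  one   = fromℕ< (ℕ.<-trans (s≤s (s≤s z≤n)) 3<n)
  three = fromℕ< 3<n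

  toℕ-one : toℕ one ≡ 1
  toℕ-one = toℕ-fromℕ< (ℕ.<-trans (s≤s (s≤s z≤n)) 3<n)

  toℕ-three : toℕ three ≡ 3
  toℕ-three = toℕ-fromℕ< 3<n

  one³≡three : pow ℤₙ one 3 ≡ three
  one³≡three = toℕ-injective (begin
    toℕ (pow ℤₙ one 3) ≡⟨ toℕ-pow n one 3 ⟩
    (3 * toℕ one) % n  ≡⟨ cong (λ x → (3 * x) % n) toℕ-one ⟩
    3 % n              ≡⟨ m<n⇒m%n≡m 3<n ⟩
    3                  ≡⟨ toℕ-three ⟨
    toℕ three          ∎)
    where open ≡-Reasoning

  ℤₙ-lacksExponent : ¬ HasExponent ℤₙ M
  ℤₙ-lacksExponent exponent = M≢0 (begin
    M                  ≡⟨ m<n⇒m%n≡m M<n ⟨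
    M % n              ≡⟨ cong (_% n) (ℕ.*-identityʳ M) ⟨
    (M * 1) % n        ≡⟨ cong (λ x → (M * x) % n) toℕ-one ⟨
    (M * toℕ one) % n  ≡⟨ toℕ-pow n one M ⟨
    toℕ (pow ℤₙ one M) ≡⟨ cong toℕ (exponent one) ⟩
    toℕ (Modular.0ₘ n) ≡⟨ Modular.toℕ-0ₘ n ⟩
    0                  ∎)
    where
      open ≡-Reasoning
      M≢0 : M ≢ 0
      M≢0 ()

  ℤ₂×ℤₘ-hasExponent : HasExponent (ℤ/ 2 ⊗ ℤ/ M) M
  ℤ₂×ℤₘ-hasExponent = ⊗-hasExponent {d = M} {ℤ/ 2} {ℤ/ M} (ℤ/-hasExponent 2 (∣-trans (m∣m*n 2) (m∣m*n K))) (ℤ/-hasExponent M ∣-refl)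

  open Adversary (ℕ.<⇒≤ M<n) (ℤ/ M)
  open Extension
  module Cyclic = Realisation double-homomorphism double-injective
  module Split  = Realisation (⊗-inj₂-homomorphism (ℤ/ 2) (ℤ/ M)) (⊗-inj₂-injective (ℤ/ 2) (ℤ/ M))

  one-unconfined : ∀ π → ¬ Cyclic.Confined π (π ⟨$⟩ˡ one)
  one-unconfined π (i , π[π⁻¹one]≡double) = odd≢double 0 i toℕ-one (trans (sym (Perm.inverseʳ π)) π[π⁻¹one]≡double)

  odd∉image : ∀ {a} m P → toℕ a ≡ suc (2 * m) → a ∉ List.map proj₂ (Cyclic.image P)
  odd∉image m P a-odd a∈ with ∈-map⁻ double (subst (_ ∈_) (cod-map₂ P) a∈)
  ... | i , _ , a≡double = odd≢double m i a-odd a≡double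

  Decided : ∀ {O} → Tree (Fin n × Fin n) (Fin n) O → Set
  Decided {O} T = Σ[ o ∈ O ] Σ[ E ∈ Extension [] (K * 3) ] (∀ {t} → Respects t (labelling E) → run T t ≡ o)

  lowerBound-or-decided : ∀ {O} (T : Tree (Fin n × Fin n) (Fin n) O) → (∃[ G ] K ≤ cost T (table G)) ⊎ Decided T
  lowerBound-or-decided T with play K T [] [] (ℕ.≤-trans (ℕ.m≤m+n (K * 3) K) (ℕ.≤-reflexive K*3+K≡M))
  ... | E , halts o runs = inj₂ (o , E , runs)
  ... | E , slow bound with Cyclic.realise (isPartialInjection E)
  ...   | π , realises = inj₁ (relabel ℤₙ π , bound (Cyclic.realises⇒respects {π} {labelling E} realises))

  isomorphism-lowerBound : (T : Tree (Bool × Fin n × Fin n) (Fin n) Bool) → DecidesIso T →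
                           ∃[ G ] ∃[ H ] K ≤ cost T (table₂ G H)
  isomorphism-lowerBound T decides with lowerBound-or-decided (answerFirstGroup ℤₙ T)
  ... | inj₁ (H , K≤cost) = ℤₙ , H , ℕ.≤-trans K≤cost (cost-answerFirstGroup ℤₙ H T)
  ... | inj₂ (o , E , runs) =
    ⊥-elim (ℤₙ-lacksExponent (isomorphic-hasExponent {d = M} {ℤₙ} {G₂} ℤₙ≅G₂
                                (relabel-hasExponent {d = M} (ℤ/ 2 ⊗ ℤ/ M) π₂ ℤ₂×ℤₘ-hasExponent)))
    where
      P = labelling E
      π₁ = proj₁ (Cyclic.realise (isPartialInjection E))
      π₂ = proj₁ (Split.realise (isPartialInjection E))
      G₁ = relabel ℤₙ π₁
      G₂ = relabel (ℤ/ 2 ⊗ ℤ/ M) π₂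

      runs₂ : ∀ G → Respects (table G) P → run T (table₂ ℤₙ G) ≡ o
      runs₂ G respects = trans (sym (run-answerFirstGroup ℤₙ G T)) (runs respects)

      ℤₙ≅G₂ : Isomorphic ℤₙ G₂
      ℤₙ≅G₂ = Equivalence.to (decides ℤₙ G₂) (begin
        run T (table₂ ℤₙ G₂) ≡⟨ runs₂ G₂ (Split.realises⇒respects {π₂} {P} (proj₂ (Split.realise (isPartialInjection E)))) ⟩
        o                    ≡⟨ runs₂ G₁ (Cyclic.realises⇒respects {π₁} {P} (proj₂ (Cyclic.realise (isPartialInjection E)))) ⟨
        run T (table₂ ℤₙ G₁) ≡⟨ Equivalence.from (decides ℤₙ G₁) (relabel-isomorphic ℤₙ π₁) ⟩
        true                 ∎)
        where open ≡-Reasoning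

  -- Send v to the odd element one and u to three = one³, so that u lies in the cyclic subgroup of v.
  power-realisation : ∀ {P} → IsPartialInjection P → ∀ {u v} → u ≢ v → u ∉ dom P → v ∉ dom P →
                      ∃ λ π → Realises π (Cyclic.image P) × u ≡ pow (relabel ℤₙ π) v 3
  power-realisation {P} P-inj {u} {v} u≢v u∉ v∉ = π , All.tail (All.tail realises) , u≡v³
    where
      Q : List (Fin n × Fin n)
      Q = (u , three) ∷ (v , one) ∷ Cyclic.image P

      3≢1 : 3 ≢ 1
      3≢1 ()

      u-fresh : u ∉ v ∷ List.map proj₁ (Cyclic.image P)
      u-fresh (here u≡v) = u≢v u≡v
      u-fresh (there u∈) = u∉ (subst (u ∈_) (dom-map₂ P) u∈)

      v-fresh : v ∉ List.map proj₁ (Cyclic.image P)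
      v-fresh v∈ = v∉ (subst (v ∈_) (dom-map₂ P) v∈)

      three-fresh : three ∉ one ∷ List.map proj₂ (Cyclic.image P)
      three-fresh (here three≡one) = 3≢1 (trans (sym toℕ-three) (trans (cong toℕ three≡one) toℕ-one))
      three-fresh (there three∈)   = odd∉image 1 P toℕ-three three∈

      Q-inj : IsPartialInjection Q
      Q-inj = cons u-fresh three-fresh
                   (cons v-fresh (odd∉image 0 P toℕ-one)
                         (map₂-isPartialInjection double-injective P-inj))

      π : Permutation′ n
      π = proj₁ (isPartialInjection⇒permutation Q-inj)

      realises : Realises π Q
      realises = proj₂ (isPartialInjection⇒permutation Q-inj)

      u≡v³ : u ≡ pow (relabel ℤₙ π) v 3
      u≡v³ = ⟨$⟩ʳ-injective π (begin
        π ⟨$⟩ʳ u                     ≡⟨ All.head realises ⟩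
        three                        ≡⟨ one³≡three ⟨
        pow ℤₙ one 3                 ≡⟨ cong (λ x → pow ℤₙ x 3) (All.head (All.tail realises)) ⟨
        pow ℤₙ (π ⟨$⟩ʳ v) 3          ≡⟨ IsHomomorphism.pow-homo (relabel-homomorphism ℤₙ π) v 3 ⟨
        π ⟨$⟩ʳ pow (relabel ℤₙ π) v 3 ∎)
        where open ≡-Reasoning

  no-common-basis : ∀ {P L} → IsPartialInjection P → length P ≤ K * 3 →
                    ¬ (∀ {G} → Respects (table G) P → IsBasis G L)
  no-common-basis {P} {L} P-inj |P|≤ basis with outsiders _≟_ (dom P) L
  ... | atMostOne os |os|≤1 L⊆ =
    one-unconfined π (basis-generates (Cyclic.confined-isSubgroup π) (basis respects)
                                     (All.map (All.lookup confines) L⊆) (π ⟨$⟩ˡ one))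
    where open Cyclic.Confinement (Cyclic.confine P-inj os (room |P|≤ (ℕ.≤-trans |os|≤1 (s≤s z≤n))))
  ... | two as u bs v cs u∉ v∉ with u ≟ v
  ...   | yes refl = IsBasis⇒¬InCyclic G as u bs u cs (basis (Cyclic.realises⇒respects {π} {P} realises))
                                       (1 , sym (identityʳ u))
    where
      π = proj₁ (Cyclic.realise P-inj)
      realises = proj₂ (Cyclic.realise P-inj)
      G = relabel ℤₙ π
      open IsAbelianGroup (AbGroupOn.isAbGroup G) using (identityʳ)
  ...   | no u≢v = IsBasis⇒¬InCyclic (relabel ℤₙ π) as u bs v cs
                     (basis (Cyclic.realises⇒respects {π} {P} (proj₁ (proj₂ R)))) (3 , proj₂ (proj₂ R))
    where
      R = power-realisation P-inj u≢v u∉ v∉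
      π = proj₁ R

  basis-lowerBound : (T : Tree (Fin n × Fin n) (Fin n) (List (Fin n))) → FindsBasis T →
                     ∃[ G ] K ≤ cost T (table G)
  basis-lowerBound T finds with lowerBound-or-decided T
  ... | inj₁ expensive = expensive
  ... | inj₂ (L , E , runs) =
    ⊥-elim (no-common-basis (isPartialInjection E) (size E) λ {G} respects → subst (IsBasis G) (runs respects) (finds G))

  presentation-lowerBound : ∀ {s} → s n ≤ K → (T : Tree (Fin n × Fin n) (Fin n) (PresOut n)) →
                            FindsPresentation s T → ∃[ G ] K ≤ cost T (table G)
  presentation-lowerBound {s} s[n]≤K T finds with lowerBound-or-decided T
  ... | inj₁ expensive = expensive
  ... | inj₂ ((gs , rs) , E , runs) = ⊥-elim (
    one-unconfined π (presentation-generates (Cyclic.confined-isSubgroup π) (proj₁ (found π respects))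
                                            (All.++⁻ˡ gs confines) (π ⟨$⟩ˡ one)))
    where
      found : ∀ π → Respects (table (relabel ℤₙ π)) (labelling E) →
              Presents (relabel ℤₙ π) (gs , rs) × length gs + length rs ≤ s n
      found π respects = subst (λ o → Presents (relabel ℤₙ π) o × presSize (relabel ℤₙ π) o ≤ s n)
                               (runs respects) (finds (relabel ℤₙ π))

      |gs|≤K : length gs ≤ K
      |gs|≤K = ℕ.≤-trans (ℕ.m≤m+n (length gs) (length rs)) (ℕ.≤-trans (proj₂ (found π₀ respects₀)) s[n]≤K)
        where
          π₀ = proj₁ (Cyclic.realise (isPartialInjection E))
          respects₀ = Cyclic.realises⇒respects {π₀} {labelling E} (proj₂ (Cyclic.realise (isPartialInjection E)))

      open Cyclic.Confinement (Cyclic.confine (isPartialInjection E) gs (room (size E) |gs|≤K))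

mainTheorem5 :
    -- (1) isomorphism testing
    (∃[ c ] ((N : ℕ) → ∃[ n ] (N ≤ n ×
      ((T : Tree (Bool × Fin n × Fin n) (Fin n) Bool) → DecidesIso T →
        ∃[ G ] ∃[ H ] n ≤ c * cost T (table₂ G H))))) ×
    -- (2) finding a basis
    (∃[ c ] ((N : ℕ) → ∃[ n ] (N ≤ n ×
      ((T : Tree (Fin n × Fin n) (Fin n) (List (Fin n))) → FindsBasis T →
        ∃[ G ] n ≤ c * cost T (table G))))) ×
    -- (3) finding a presentation of size at most s(n) = n^{o(1)}
    ((s : ℕ → ℕ) → SubPolynomial s → ∃[ c ] ((N : ℕ) → ∃[ n ] (N ≤ n ×
      ((T : Tree (Fin n × Fin n) (Fin n) (PresOut n)) → FindsPresentation s T →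
        ∃[ G ] n ≤ c * cost T (table G)))))
mainTheorem5 =
    (8 , λ N → let open LowerBounds N in
      n , k≤n , λ T decides → let G , H , K≤cost = isomorphism-lowerBound T decides in G , H , n≤8* K≤cost)
  , (8 , λ N → let open LowerBounds N in
      n , k≤n , λ T finds → let G , K≤cost = basis-lowerBound T finds in G , n≤8* K≤cost)
  , λ s subpolynomial → 8 , λ N →
      let N₀ , s²≤n = subpolynomial 1
          open LowerBounds (7 + (N + N₀))
          N≤k = ℕ.≤-trans (ℕ.m≤m+n N N₀) (ℕ.m≤n+m (N + N₀) 7)
          N₀≤k = ℕ.≤-trans (ℕ.m≤n+m N₀ N) (ℕ.m≤n+m (N + N₀) 7)
          s[n]≤K = square-bound {s n} (ℕ.m≤m+n 8 (N + N₀)) (subst (s n ^ 2 ≤_) n≡8*K (s²≤n n (ℕ.≤-trans N₀≤k k≤n)))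
      in n , ℕ.≤-trans N≤k k≤n , λ T finds →
        let G , K≤cost = presentation-lowerBound {s} s[n]≤K T finds in G , n≤8* K≤cost
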